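{- Let $n\geq2$ be even and $q$ a prime power. Let $Z^0=\sum c^0_{a_0,\ldots,a_n}(q)x_0^{a_0}\cdots x_n^{a_n}$ be the formal power series satisfying the functional equations below with diagonal coefficients $c^0_{0,\ldots,0}=1$ and $c^0_{a,\ldots,a}=0$ for $a>0$, and let $P(x)=\sum_{a\ge0}p_a(q)x^a$ with $p_a(q)=q^{3a/2-a(n+2)}c^0_{a,2a,a,2a,\ldots,2a,a}(q)$. Then $P(x)$ is an even power series in $x$, i.e. $p_a(q)=0$ for all odd $a$.
   Context: Indices modulo $n+1$. $\sigma_i$: $(\sigma_i(x))_j=q^{ -1}x_i^{ -1}$ if $j\equiv i$, $q^{1/2}x_ix_j$ if $j\equiv i\pm1$, $x_j$ otherwise. Functional equations: for each $i$, $Z^{(i)}_{\mathrm{odd}}(\sigma_i(x))=q^{1/2}x_iZ^{(i)}_{\mathrm{odd}}(x)$ and $(1-x_i^{ -1})Z^{(i)}_{\mathrm{even}}(\sigma_i(x))=(1-qx_i)Z^{(i)}_{\mathrm{even}}(x)$, where $Z^{(i)}_{\mathrm{odd/even}}$ is the sum of terms with $a_{i-1}+a_{i+1}$ odd/even; formally: for fixed $a_j$ ($j\ne i$), $\Lambda(x_i)=\sum_{a_i}c_ax_i^{a_i}$ is a polynomial with $(q^{1/2}x_i)^{a_{i-1}+a_{i+1}-1}\Lambda(q^{ -1}x_i^{ -1})=\Lambda(x_i)$ if $a_{i-1}+a_{i+1}$ is odd, and a rational function with denominator $1-qx_i$ with $(q^{1/2}x_i)^{a_{i-1}+a_{i+1}}(1-x_i^{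 -1})\Lambda(q^{ -1}x_i^{ -1})=(1-qx_i)\Lambda(x_i)$ if even. Such a series is determined by its diagonal coefficients. -}

module Defs where

open import Data.Nat as ℕ using (ℕ; zero; suc; _≤_; _<_; _∸_)
open import Data.Nat.Primality using (Prime)
open import Data.Integer using (+_)
open import Data.Rational using (ℚ; 0ℚ; 1ℚ; _/_; _*_; _-_)
open import Data.Fin using (Fin; toℕ)
open import Data.Nat.DivMod using (_mod_)
open import Data.Vec using (Vec; lookup; tabulate; _[_]≔_)
open import Data.Product using (∃; _×_)
open import Data.Bool using (Bool; true; not; if_then_else_)
open import Relation.Binary.PropositionalEquality using (_≡_)

Even : ℕ → Set
Even m = ∃ λ t → m ≡ 2 ℕ.* t

Odd : ℕ → Set
Odd m = ∃ λ t → m ≡ suc (2 ℕ.* t)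

IsPrimePower : ℕ → Set
IsPrimePower q = ∃ λ p → ∃ λ k → Prime p × 1 ≤ k × q ≡ p ℕ.^ k

ℕ→ℚ : ℕ → ℚ
ℕ→ℚ m = + m / 1

infixr 8 _^ℚ_
_^ℚ_ : ℚ → ℕ → ℚ
x ^ℚ zero  = 1ℚ
x ^ℚ suc k = x * (x ^ℚ k)

succF : {n : ℕ} → Fin (suc n) → Fin (suc n)
succF {n} i = suc (toℕ i) mod suc n

predF : {n : ℕ} → Fin (suc n) → Fin (suc n)
predF {n} i = (toℕ i ℕ.+ n) mod suc n

-- A coefficient family c_a (a ∈ ℕ^{n+1}, stored as a vector) of the formal
-- power series Z = Σ c_a x_0^{a_0} ⋯ x_n^{a_n}.
Coeffs : ℕ → Set
Coeffs n = Vec ℕ (suc n) → ℚ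

module _ {n : ℕ} (q : ℚ) (c : Coeffs n) (i : Fin (suc n)) (a : Vec ℕ (suc n)) where

  mOf : ℕ
  mOf = lookup a (predF i) ℕ.+ lookup a (succF i)

  -- Λ(x_i) = Σ_k Λc k x_i^k  (the a_j, j ≠ i, fixed)
  Λc : ℕ → ℚ
  Λc k = c (a [ i ]≔ k)

  -- coefficients of (1 - q x_i) Λ(x_i)
  Rc : ℕ → ℚ
  Rc zero    = Λc zero
  Rc (suc k) = Λc (suc k) - q * Λc k

  -- m = 2t+1 odd: Λ is a polynomial (degree ≤ m-1 = 2t) and
  -- (q^{1/2} x)^{m-1} Λ(q^{-1} x^{-1}) = Λ(x), i.e. coefficientwise
  -- c_{2t-k} = q^{t-k} c_k for k ≤ 2t (multiplied out by q^k).
  OddEq : Set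
  OddEq = ∀ t → mOf ≡ suc (2 ℕ.* t) →
            (∀ k → 2 ℕ.* t < k → Λc k ≡ 0ℚ) ×
            (∀ k → k ≤ 2 ℕ.* t → Λc (2 ℕ.* t ∸ k) * (q ^ℚ k) ≡ (q ^ℚ t) * Λc k)

  -- m = 2t even: R(x) = (1 - q x) Λ(x) is a polynomial (of degree ≤ m, forced)
  -- and (q^{1/2} x)^m (1 - x^{-1}) Λ(q^{-1}x^{-1}) = (1 - q x) Λ(x), which is
  -- q^{t} x^{2t} R(q^{-1} x^{-1}) = R(x), i.e. r_{2t-k} q^k = q^t r_k.
  EvenEq : Set
  EvenEq = ∀ t → mOf ≡ 2 ℕ.* t →
            (∀ k → 2 ℕ.* t < k → Rc k ≡ 0ℚ) ×
            (∀ k → k ≤ 2 ℕ.* t → Rc (2 ℕ.* t ∸ k) * (q ^ℚ k) ≡ (q ^ℚ t) * Rc k)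

FunctionalEquations : (n q : ℕ) → Coeffs n → Set
FunctionalEquations n q c =
  ∀ (i : Fin (suc n)) (a : Vec ℕ (suc n)) →
    OddEq (ℕ→ℚ q) c i a × EvenEq (ℕ→ℚ q) c i a

evenᵇ : ℕ → Bool
evenᵇ zero = true
evenᵇ (suc k) = not (evenᵇ k)

pattern-a2a : (n a : ℕ) → Vec ℕ (suc n)
pattern-a2a n a = tabulate λ (j : Fin (suc n)) →
  if evenᵇ (toℕ j) then a else 2 ℕ.* a

{-# OPTIONS --safe #-}
-- Call v ∈ ℕ^{n+1} odd if Σ_j v_j v_{j+1} (indices mod n+1) is odd; for even n and
-- odd a the vector (a,2a,…,2a,a) is odd, since only the wrap-around product a·a is odd.
-- We show c_v = 0 for every odd v by induction on Σ_j v_j.  If 2v_i ≤ v_{i-1} + v_{i+1}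
-- for all i, the maximum principle on the cycle makes v constant, and the diagonal
-- hypothesis applies (the zero vector is not odd).  Otherwise m = v_{i-1} + v_{i+1} < 2v_i
-- for some i.  Replacing v_i by k changes Σ_j v_j v_{j+1} by (k - v_i)m, so v stays odd
-- when (v_i + k)m is even; and the functional equation at i says that Λ(x_i) (m odd) or
-- (1 - q x_i)Λ(x_i) (m even) is palindromic about t < v_i, where m = 2t+1 or 2t, forcing the
-- coefficient of x_i^{v_i} to vanish once these smaller odd coefficients do.
module Submission where

open import Defs
open import Data.Nat using (ℕ; suc; _≤_)
open import Data.Vec using (Vec; replicate)
open import Data.Rational using (ℚ; 0ℚ; 1ℚ)
open import Relation.Binary.PropositionalEquality using (_≡_)

open import Level using (0ℓ)
open import Function using (_∘_; id)
open import Data.Bool using (true; false; not; if_then_else_)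
open import Data.Bool.Properties using (not-involutive)
open import Data.Product using (∃; _×_; _,_; proj₁; proj₂)
open import Data.Sum using (_⊎_; inj₁; inj₂)
open import Data.Nat using (zero; _+_; _*_; _^_; _∸_; _<_; _≤?_; z≤n; s≤s; NonZero)
open import Data.Nat.Properties
open import Data.Nat.Divisibility
  using (_∣_; _∤_; _∣0; ∣1⇒≡1; ∣m+n∣m⇒∣n; ∣m∣n⇒∣m+n; m∣m*n; ∣m⇒∣m*n; ∣n⇒∣m*n)
open import Data.Nat.DivMod using (_%_; n%n≡0; [m+n]%n≡m%n; m<n⇒m%n≡m)
open import Data.Nat.Tactic.RingSolver using (solve-∀)
open import Data.Nat.Primality using (prime⇒nonZero)
open import Data.Fin using (Fin; zero; suc; toℕ; inject₁; fromℕ; punchIn)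
open import Data.Fin.Properties
  using (toℕ-injective; toℕ-fromℕ<; toℕ-fromℕ; toℕ-inject₁; toℕ<n; punchInᵢ≢i; all?; ¬∀⟶∃¬)
  renaming (_≟_ to _≟ᶠ_)
open import Data.Fin.Induction using (<-weakInduction)
open import Data.Vec using (lookup; _[_]≔_; []; _∷_)
open import Data.Vec.Properties using (lookup∘update; lookup∘update′; lookup-replicate; lookup∘tabulate; []≔-lookup)
open import Data.Vec.Functional using (updateAt)
open import Data.Vec.Functional.Properties using (updateAt-updates; updateAt-minimal)
open import Algebra.Properties.CommutativeMonoid.Sum +-0-commutativeMonoid
  using (sum; sum-remove; sum-cong-≗; sum-init-last; sum-replicate-zero)
import Data.Rational as ℚ
import Data.Rational.Properties as ℚₚ
open import Induction.WellFounded using (module All)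
open import Data.Nat.Induction using (<-wellFounded)
open import Relation.Binary.Construct.On as On using ()
open import Relation.Binary.PropositionalEquality
  using (_≢_; refl; sym; trans; cong; cong₂; subst; module ≡-Reasoning)
open import Relation.Nullary using (Dec; yes; no; contradiction)

odd⇒2∤ : ∀ {m} → Odd m → 2 ∤ m
odd⇒2∤ (t , refl) 2∣1+2t =
  contradiction (∣1⇒≡1 (∣m+n∣m⇒∣n (subst (2 ∣_) (+-comm 1 (2 * t)) 2∣1+2t) (m∣m*n t))) λ ()

odd*odd⇒odd : ∀ {m n} → Odd m → Odd n → Odd (m * n)
odd*odd⇒odd (s , refl) (t , refl) = s + t * suc (2 * s) , expand s t
  where
  expand : ∀ s t → suc (2 * s) * suc (2 * t) ≡ suc (2 * (s + t * suc (2 * s)))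
  expand = solve-∀

even-or-odd : ∀ m → Even m ⊎ Odd m
even-or-odd zero = inj₁ (0 , refl)
even-or-odd (suc m) with even-or-odd m
... | inj₁ (t , refl) = inj₂ (t , refl)
... | inj₂ (t , refl) = inj₁ (suc t , cong suc (sym (+-suc t (t + 0))))

even⇒evenᵇ : ∀ {m} → Even m → evenᵇ m ≡ true
even⇒evenᵇ (t , refl) = evenᵇ-double t
  where
  evenᵇ-double : ∀ t → evenᵇ (2 * t) ≡ true
  evenᵇ-double zero = refl
  evenᵇ-double (suc t) rewrite +-suc t (t + 0) = trans (not-involutive _) (evenᵇ-double t)

2∣-transfer : ∀ {s s′ x y} → s′ + x ≡ s + y → 2 ∣ x + y → 2 ∣ s′ → 2 ∣ s
2∣-transfer {s} {s′} {x} {y} eq 2∣x+y 2∣s′ =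
  ∣m+n∣m⇒∣n (subst (2 ∣_) regroup (∣m∣n⇒∣m+n 2∣s′ 2∣x+y)) (m∣m*n y)
  where
  open ≡-Reasoning
  shuffle : ∀ s y → s + y + y ≡ 2 * y + s
  shuffle = solve-∀
  regroup : s′ + (x + y) ≡ 2 * y + s
  regroup = begin
    s′ + (x + y) ≡⟨ +-assoc s′ x y ⟨
    s′ + x + y   ≡⟨ cong (_+ y) eq ⟩
    s + y + y    ≡⟨ shuffle s y ⟩
    2 * y + s    ∎

data Last-or-inject₁ : ∀ {n} → Fin (suc n) → Set where
  last  : ∀ {n} → Last-or-inject₁ (fromℕ n)
  inner : ∀ {n} (j : Fin n) → Last-or-inject₁ (inject₁ j)

last-or-inject₁ : ∀ {n} (i : Fin (suc n)) → Last-or-inject₁ i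
last-or-inject₁ {zero} zero = last
last-or-inject₁ {suc n} zero = inner zero
last-or-inject₁ {suc n} (suc i) with last-or-inject₁ i
... | last = last
... | inner j = inner (suc j)

module _ {n : ℕ} where
  open ≡-Reasoning

  succF-inject₁ : (j : Fin n) → succF (inject₁ j) ≡ suc j
  succF-inject₁ j = toℕ-injective (begin
    toℕ (succF (inject₁ j))       ≡⟨ toℕ-fromℕ< _ ⟩
    suc (toℕ (inject₁ j)) % suc n ≡⟨ cong (λ x → suc x % suc n) (toℕ-inject₁ j) ⟩
    suc (toℕ j) % suc n           ≡⟨ m<n⇒m%n≡m (s≤s (toℕ<n j)) ⟩
    suc (toℕ j)                   ∎)

  succF-fromℕ : succF (fromℕ n) ≡ zero
  succF-fromℕ = toℕ-injective (begin
    toℕ (succF (fromℕ n))       ≡⟨ toℕ-fromℕ< _ ⟩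
    suc (toℕ (fromℕ n)) % suc n ≡⟨ cong (λ x → suc x % suc n) (toℕ-fromℕ n) ⟩
    suc n % suc n               ≡⟨ n%n≡0 (suc n) ⟩
    0                           ∎)

  predF-zero : predF zero ≡ fromℕ n
  predF-zero = toℕ-injective (begin
    toℕ (predF {n} zero) ≡⟨ toℕ-fromℕ< _ ⟩
    n % suc n            ≡⟨ m<n⇒m%n≡m ≤-refl ⟩
    n                    ≡⟨ toℕ-fromℕ n ⟨
    toℕ (fromℕ n)        ∎)

  predF-suc : (j : Fin n) → predF (suc j) ≡ inject₁ j
  predF-suc j = toℕ-injective (begin
    toℕ (predF (suc j))       ≡⟨ toℕ-fromℕ< _ ⟩
    (suc (toℕ j) + n) % suc n ≡⟨ cong (_% suc n) (+-suc (toℕ j) n) ⟨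
    (toℕ j + suc n) % suc n   ≡⟨ [m+n]%n≡m%n (toℕ j) (suc n) ⟩
    toℕ j % suc n             ≡⟨ m<n⇒m%n≡m (m<n⇒m<1+n (toℕ<n j)) ⟩
    toℕ j                     ≡⟨ toℕ-inject₁ j ⟨
    toℕ (inject₁ j)           ∎)

  predF-succF : (i : Fin (suc n)) → predF (succF i) ≡ i
  predF-succF i with last-or-inject₁ i
  ... | last = trans (cong predF succF-fromℕ) predF-zero
  ... | inner j = trans (cong predF (succF-inject₁ j)) (predF-suc j)

  succF-predF : (i : Fin (suc n)) → succF (predF i) ≡ i
  succF-predF zero = trans (cong succF predF-zero) succF-fromℕ
  succF-predF (suc j) = trans (cong succF (predF-suc j)) (succF-inject₁ j)

  succF≢ : 1 ≤ n → (i : Fin (suc n)) → succF i ≢ i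
  succF≢ 1≤n i eq with last-or-inject₁ i
  succF≢ (s≤s _) _ eq | last with () ← trans (sym succF-fromℕ) eq
  ... | inner j = 1+n≢n (begin
    suc (toℕ j)          ≡⟨ cong toℕ (trans (sym (succF-inject₁ j)) eq) ⟩
    toℕ (inject₁ j)      ≡⟨ toℕ-inject₁ j ⟩
    toℕ j                ∎)

  predF≢ : 1 ≤ n → (i : Fin (suc n)) → predF i ≢ i
  predF≢ 1≤n i eq = succF≢ 1≤n i (sym (trans (sym (succF-predF i)) (cong succF eq)))

  cycle-closed⇒all : (P : Fin (suc n) → Set) →
                     (∀ {i} → P i → P (succF i)) → (∀ {i} → P i → P (predF i)) →
                     ∀ {i} → P i → ∀ j → P j
  cycle-closed⇒all P up down {i} Pi =
    <-weakInduction P (reach-zero i Pi) (λ j → subst P (succF-inject₁ j) ∘ up)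
    where
    reach-zero : ∀ i → P i → P zero
    reach-zero = <-weakInduction (λ i → P i → P zero) id
                   (λ j back → back ∘ subst P (predF-suc j) ∘ down)

sum-update : ∀ {N} (f g : Fin (suc N) → ℕ) (i : Fin (suc N)) →
             (∀ j → j ≢ i → f j ≡ g j) → sum f + g i ≡ sum g + f i
sum-update f g i agree = begin
  sum f + g i                              ≡⟨ cong (_+ g i) (sum-remove {i = i} f) ⟩
  f i + sum (f ∘ punchIn i) + g i          ≡⟨ cong (λ r → f i + r + g i) rest ⟩
  f i + sum (g ∘ punchIn i) + g i          ≡⟨ swap (f i) (sum (g ∘ punchIn i)) (g i) ⟩
  g i + sum (g ∘ punchIn i) + f i          ≡⟨ cong (_+ f i) (sum-remove {i = i} g) ⟨
  sum g + f i                              ∎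
  where
  open ≡-Reasoning
  rest : sum (f ∘ punchIn i) ≡ sum (g ∘ punchIn i)
  rest = sum-cong-≗ (λ j → agree (punchIn i j) (punchInᵢ≢i i j))
  swap : ∀ a r b → a + r + b ≡ b + r + a
  swap = solve-∀

sum-update₂ : ∀ {N} (f g : Fin (suc N) → ℕ) {i p : Fin (suc N)} → i ≢ p →
              (∀ j → j ≢ i → j ≢ p → f j ≡ g j) →
              sum f + (g i + g p) ≡ sum g + (f i + f p)
sum-update₂ f g {i} {p} i≢p agree = begin
  sum f + (g i + g p)   ≡⟨ +-assoc (sum f) (g i) (g p) ⟨
  sum f + g i + g p     ≡⟨ swap (sum f) (g i) (g p) ⟩
  sum f + g p + g i     ≡⟨ cong (λ z → sum f + z + g i) (updateAt-updates p f) ⟨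
  sum f + h p + g i     ≡⟨ cong (_+ g i) (sum-update f h p f≈h) ⟩
  sum h + f p + g i     ≡⟨ swap (sum h) (f p) (g i) ⟩
  sum h + g i + f p     ≡⟨ cong (_+ f p) (sum-update h g i h≈g) ⟩
  sum g + h i + f p     ≡⟨ cong (λ x → sum g + x + f p) (updateAt-minimal i p f i≢p) ⟩
  sum g + f i + f p     ≡⟨ +-assoc (sum g) (f i) (f p) ⟩
  sum g + (f i + f p)   ∎
  where
  open ≡-Reasoning
  swap : ∀ s a b → s + a + b ≡ s + b + a
  swap = solve-∀
  h : Fin (suc _) → ℕ
  h = updateAt f p λ _ → g p
  f≈h : ∀ j → j ≢ p → f j ≡ h j
  f≈h j j≢p = sym (updateAt-minimal j p f j≢p)
  h≈g : ∀ j → j ≢ i → h j ≡ g j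
  h≈g j j≢i with j ≟ᶠ p
  ... | yes refl = updateAt-updates p f
  ... | no j≢p = trans (updateAt-minimal j p f j≢p) (agree j j≢i j≢p)

∣-sum : ∀ {d N} (f : Fin N → ℕ) → (∀ j → d ∣ f j) → d ∣ sum f
∣-sum {d} {zero} f _ = d ∣0
∣-sum {N = suc N} f d∣f = ∣m∣n⇒∣m+n (d∣f zero) (∣-sum (f ∘ suc) (d∣f ∘ suc))

module _ {n : ℕ} where

  total : Vec ℕ (suc n) → ℕ
  total v = sum (lookup v)

  adjacentProductSum : Vec ℕ (suc n) → ℕ
  adjacentProductSum v = sum λ j → lookup v j * lookup v (succF j)

  neighbourSum : Vec ℕ (suc n) → Fin (suc n) → ℕ
  neighbourSum v i = lookup v (predF i) + lookup v (succF i)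

  subharmonicAt? : ∀ v i → Dec (2 * lookup v i ≤ neighbourSum v i)
  subharmonicAt? v i = 2 * lookup v i ≤? neighbourSum v i

  total-update : ∀ v i k → total (v [ i ]≔ k) + lookup v i ≡ total v + k
  total-update v i k =
    trans (sum-update (lookup (v [ i ]≔ k)) (lookup v) i (λ j j≢i → lookup∘update′ j≢i v k))
          (cong (total v +_) (lookup∘update i v k))

  adjacentProductSum-update : 1 ≤ n → ∀ v i k →
    adjacentProductSum (v [ i ]≔ k) + lookup v i * neighbourSum v i ≡
    adjacentProductSum v + k * neighbourSum v i
  adjacentProductSum-update 1≤n v i k = begin
    S v′ + a * (x + y)        ≡⟨ cong (S v′ +_) (split a x y) ⟩
    S v′ + (a * y + x * a)    ≡⟨ cong (λ z → S v′ + (a * y + z)) (cong (λ j → x * lookup v j) (succF-predF i)) ⟨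
    S v′ + (T v i + T v p)    ≡⟨ sum-update₂ (T v′) (T v) (λ i≡p → predF≢ 1≤n i (sym i≡p)) agree ⟩
    S v + (T v′ i + T v′ p)   ≡⟨ cong₂ (λ z w → S v + (z + w)) T′i T′p ⟩
    S v + (k * y + x * k)     ≡⟨ cong (S v +_) (split k x y) ⟨
    S v + k * (x + y)         ∎
    where
    open ≡-Reasoning
    S = adjacentProductSum
    T : Vec ℕ (suc n) → Fin (suc n) → ℕ
    T w j = lookup w j * lookup w (succF j)
    v′ = v [ i ]≔ k
    p = predF i
    a = lookup v i
    x = lookup v p
    y = lookup v (succF i)
    split : ∀ a x y → a * (x + y) ≡ a * y + x * a
    split = solve-∀
    T′i : T v′ i ≡ k * y
    T′i = cong₂ _*_ (lookup∘update i v k) (lookup∘update′ (succF≢ 1≤n i) v k)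
    T′p : T v′ p ≡ x * k
    T′p = cong₂ _*_ (lookup∘update′ (predF≢ 1≤n i) v k)
                    (trans (cong (lookup v′) (succF-predF i)) (lookup∘update i v k))
    agree : ∀ j → j ≢ i → j ≢ p → T v′ j ≡ T v j
    agree j j≢i j≢p = cong₂ _*_ (lookup∘update′ j≢i v k)
      (lookup∘update′ (λ sj≡i → j≢p (trans (sym (predF-succF j)) (cong predF sj≡i))) v k)

  adjacentProductSum-zero : adjacentProductSum (replicate (suc n) 0) ≡ 0
  adjacentProductSum-zero =
    trans (sum-cong-≗ λ j → cong (_* lookup zeros (succF j)) (lookup-replicate j 0))
          (sum-replicate-zero (suc n))
    where zeros = replicate (suc n) 0

argmax : ∀ {N} (f : Fin (suc N) → ℕ) → ∃ λ i → ∀ j → f j ≤ f i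
argmax {zero} f = zero , λ { zero → ≤-refl }
argmax {suc N} f with argmax (f ∘ suc)
... | i , max with ≤-total (f zero) (f (suc i))
... | inj₁ f0≤ = suc i , λ { zero → f0≤ ; (suc j) → max j }
... | inj₂ ≤f0 = zero , λ { zero → ≤-refl ; (suc j) → ≤-trans (max j) ≤f0 }

lookup≡⇒replicate : ∀ {A : Set} {N} (v : Vec A N) {x : A} →
                    (∀ j → lookup v j ≡ x) → v ≡ replicate N x
lookup≡⇒replicate [] _ = refl
lookup≡⇒replicate (y ∷ v) v≡x = cong₂ _∷_ (v≡x zero) (lookup≡⇒replicate v (v≡x ∘ suc))

both≡max : ∀ {x y M} → x ≤ M → y ≤ M → 2 * M ≤ x + y → x ≡ M × y ≡ M
both≡max {x} {y} {M} x≤M y≤M 2M≤x+y =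
  ≤-antisym x≤M (+-cancelʳ-≤ M M x (≤-trans M+M≤x+y (+-monoʳ-≤ x y≤M))) ,
  ≤-antisym y≤M (+-cancelˡ-≤ M M y (≤-trans M+M≤x+y (+-monoˡ-≤ y x≤M)))
  where
  M+M≤x+y : M + M ≤ x + y
  M+M≤x+y = subst (_≤ x + y) (cong (M +_) (+-identityʳ M)) 2M≤x+y

subharmonic⇒constant : ∀ {n} (v : Vec ℕ (suc n)) →
                       (∀ i → 2 * lookup v i ≤ neighbourSum v i) →
                       ∃ λ M → v ≡ replicate (suc n) M
subharmonic⇒constant v sub =
  M , lookup≡⇒replicate v (cycle-closed⇒all (λ j → lookup v j ≡ M)
                             (proj₂ ∘ neighbours≡max) (proj₁ ∘ neighbours≡max) refl)
  where
  M = lookup v (proj₁ (argmax (lookup v)))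
  ≤M : ∀ j → lookup v j ≤ M
  ≤M = proj₂ (argmax (lookup v))
  neighbours≡max : ∀ {j} → lookup v j ≡ M → lookup v (predF j) ≡ M × lookup v (succF j) ≡ M
  neighbours≡max {j} vj≡M =
    both≡max (≤M (predF j)) (≤M (succF j)) (subst (λ z → 2 * z ≤ neighbourSum v j) vj≡M (sub j))

ℕ→ℚ-pos : ∀ m .{{_ : NonZero m}} → ℚ.Positive (ℕ→ℚ m)
ℕ→ℚ-pos m = ℚₚ.normalize-pos m 1

^ℚ-pos : ∀ x .{{_ : ℚ.Positive x}} k → ℚ.Positive (x ^ℚ k)
^ℚ-pos x zero = ℚₚ.normalize-pos 1 1
^ℚ-pos x (suc k) = ℚₚ.pos*pos⇒pos x (x ^ℚ k) {{^ℚ-pos x k}}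

*-zero-cancelˡ : ∀ x .{{_ : ℚ.NonZero x}} {y} → x ℚ.* y ≡ 0ℚ → y ≡ 0ℚ
*-zero-cancelˡ x {y} xy≡0 = begin
  y                     ≡⟨ ℚₚ.*-identityˡ y ⟨
  1ℚ ℚ.* y              ≡⟨ cong (ℚ._* y) (ℚₚ.*-inverseˡ x) ⟨
  ℚ.1/ x ℚ.* x ℚ.* y    ≡⟨ ℚₚ.*-assoc (ℚ.1/ x) x y ⟩
  ℚ.1/ x ℚ.* (x ℚ.* y)  ≡⟨ cong (ℚ.1/ x ℚ.*_) xy≡0 ⟩
  ℚ.1/ x ℚ.* 0ℚ         ≡⟨ ℚₚ.*-zeroʳ (ℚ.1/ x) ⟩
  0ℚ                    ∎
  where open ≡-Reasoning

-- OddEq and EvenEq of Defs say exactly that Λc, resp. Rc, is Palindromic with centre t.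
Palindromic : ℚ → (ℕ → ℚ) → ℕ → Set
Palindromic q f t =
  (∀ k → 2 * t < k → f k ≡ 0ℚ) ×
  (∀ k → k ≤ 2 * t → f (2 * t ∸ k) ℚ.* (q ^ℚ k) ≡ (q ^ℚ t) ℚ.* f k)

reflection<self : ∀ {t a} → t < a → a ≤ 2 * t → 2 * t ∸ a < a
reflection<self {t} {a} t<a a≤2t = +-cancelʳ-< a (2 * t ∸ a) a (begin-strict
  2 * t ∸ a + a ≡⟨ m∸n+n≡m a≤2t ⟩
  2 * t         <⟨ *-monoʳ-< 2 t<a ⟩
  2 * a         ≡⟨ cong (a +_) (+-identityʳ a) ⟩
  a + a         ∎)
  where open ≤-Reasoning

palindromic-vanishing : ∀ {q} .{{_ : ℚ.Positive q}} {f t a} → Palindromic q f t → t < a →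
                        (∀ k → k < a → a + k ≡ 2 * t → f k ≡ 0ℚ) → f a ≡ 0ℚ
palindromic-vanishing {q} {f} {t} {a} (degree , symmetry) t<a reflection≡0 with a ≤? 2 * t
... | no a≰2t = degree a (≰⇒> a≰2t)
... | yes a≤2t = *-zero-cancelˡ (q ^ℚ t) {{ℚₚ.pos⇒nonZero (q ^ℚ t) {{^ℚ-pos q t}}}} (begin
  q ^ℚ t ℚ.* f a                 ≡⟨ symmetry a a≤2t ⟨
  f (2 * t ∸ a) ℚ.* (q ^ℚ a)     ≡⟨ cong (ℚ._* (q ^ℚ a)) (reflection≡0 _ (reflection<self t<a a≤2t) (m+[n∸m]≡n a≤2t)) ⟩
  0ℚ ℚ.* (q ^ℚ a)                ≡⟨ ℚₚ.*-zeroˡ (q ^ℚ a) ⟩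
  0ℚ                             ∎)
  where open ≡-Reasoning

module _ {n} (q : ℚ) (c : Coeffs n) (i : Fin (suc n)) (v : Vec ℕ (suc n)) where

  Rc≡Λc-below : ∀ {a} → (∀ k → k < a → Λc q c i v k ≡ 0ℚ) →
                ∀ k → k ≤ a → Rc q c i v k ≡ Λc q c i v k
  Rc≡Λc-below Λ≡0 zero _ = refl
  Rc≡Λc-below Λ≡0 (suc k) k<a = begin
    Λ (suc k) ℚ.- q ℚ.* Λ k  ≡⟨ cong (λ z → Λ (suc k) ℚ.- q ℚ.* z) (Λ≡0 k k<a) ⟩
    Λ (suc k) ℚ.- q ℚ.* 0ℚ   ≡⟨ cong (λ z → Λ (suc k) ℚ.- z) (ℚₚ.*-zeroʳ q) ⟩
    Λ (suc k) ℚ.- 0ℚ         ≡⟨ ℚₚ.+-identityʳ (Λ (suc k)) ⟩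
    Λ (suc k)                ∎
    where
    open ≡-Reasoning
    Λ = Λc q c i v

module _ {n} (1≤n : 1 ≤ n) (q : ℚ) .{{_ : ℚ.Positive q}} (c : Coeffs n)
         (fe : ∀ i v → OddEq q c i v × EvenEq q c i v)
         (diag : ∀ a → 1 ≤ a → c (replicate (suc n) a) ≡ 0ℚ) where

  OddVanishes : Vec ℕ (suc n) → Set
  OddVanishes v = 2 ∤ adjacentProductSum v → c v ≡ 0ℚ

  VanishesBelow : Vec ℕ (suc n) → Set
  VanishesBelow v = ∀ {w} → total w < total v → OddVanishes w

  lowered-vanishes : ∀ {v} → VanishesBelow v → 2 ∤ adjacentProductSum v →
                     ∀ i {k} → k < lookup v i → 2 ∣ (lookup v i + k) * neighbourSum v i →
                     Λc q c i v k ≡ 0ℚ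
  lowered-vanishes {v} below odd i {k} k<a 2∣[a+k]m =
    below total< (odd ∘ 2∣-transfer (adjacentProductSum-update 1≤n v i k)
                                    (subst (2 ∣_) (*-distribʳ-+ m a k) 2∣[a+k]m))
    where
    a = lookup v i
    m = neighbourSum v i
    total< : total (v [ i ]≔ k) < total v
    total< = +-cancelʳ-< a _ _
      (subst (_< total v + a) (sym (total-update v i k)) (+-monoʳ-< (total v) k<a))

  peak⇒vanishes : ∀ {v} → VanishesBelow v → 2 ∤ adjacentProductSum v →
                  ∀ i → neighbourSum v i < 2 * lookup v i → c v ≡ 0ℚ
  peak⇒vanishes {v} below odd i m<2a = subst (λ w → c w ≡ 0ℚ) ([]≔-lookup v i) Λa≡0
    where
    a = lookup v i
    m = neighbourSum v i
    lowered = lowered-vanishes below odd i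
    Λa≡0 : Λc q c i v a ≡ 0ℚ
    Λa≡0 with even-or-odd m
    ... | inj₂ (t , m≡1+2t) =
      palindromic-vanishing (proj₁ (fe i v) t m≡1+2t) t<a λ k k<a a+k≡2t →
        lowered k<a (∣m⇒∣m*n m (subst (2 ∣_) (sym a+k≡2t) (m∣m*n t)))
      where
      t<a : t < a
      t<a = *-cancelˡ-< 2 t a (<-trans (n<1+n (2 * t)) (subst (_< 2 * a) m≡1+2t m<2a))
    ... | inj₁ (t , m≡2t) =
      trans (sym (R≡Λ a ≤-refl))
            (palindromic-vanishing (proj₂ (fe i v) t m≡2t) t<a λ k k<a _ →
               trans (R≡Λ k (<⇒≤ k<a)) (Λ≡0 k k<a))
      where
      t<a : t < a
      t<a = *-cancelˡ-< 2 t a (subst (_< 2 * a) m≡2t m<2a)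
      Λ≡0 : ∀ k → k < a → Λc q c i v k ≡ 0ℚ
      Λ≡0 k k<a = lowered k<a (∣n⇒∣m*n (a + k) (subst (2 ∣_) (sym m≡2t) (m∣m*n t)))
      R≡Λ : ∀ k → k ≤ a → Rc q c i v k ≡ Λc q c i v k
      R≡Λ = Rc≡Λc-below q c i v Λ≡0

  vanishing-step : ∀ v → VanishesBelow v → OddVanishes v
  vanishing-step v below odd with all? (subharmonicAt? v)
  ... | no ¬subharmonic =
    let i , 2a≰m = ¬∀⟶∃¬ _ _ (subharmonicAt? v) ¬subharmonic in peak⇒vanishes below odd i (≰⇒> 2a≰m)
  ... | yes subharmonic with subharmonic⇒constant v subharmonic
  ...   | zero , refl = contradiction (subst (2 ∣_) (sym (adjacentProductSum-zero {n})) (2 ∣0)) odd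
  ...   | suc M , refl = diag (suc M) (s≤s z≤n)

  odd-vanishing : ∀ v → OddVanishes v
  odd-vanishing = All.wfRec (On.wellFounded total <-wellFounded) 0ℓ OddVanishes vanishing-step

2∣alternating : ∀ b a → 2 ∣ (if b then a else 2 * a) * (if not b then a else 2 * a)
2∣alternating true a = ∣n⇒∣m*n a (m∣m*n a)
2∣alternating false a = ∣m⇒∣m*n a (m∣m*n a)

pattern-a2a-odd : ∀ {n a} → Even n → Odd a → 2 ∤ adjacentProductSum (pattern-a2a n a)
pattern-a2a-odd {n} {a} even-n odd-a 2∣S =
  odd⇒2∤ (odd*odd⇒odd odd-a odd-a)
    (subst (2 ∣_) T-last (∣m+n∣m⇒∣n (subst (2 ∣_) (sum-init-last T) 2∣S) (∣-sum _ T-inner)))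
  where
  entry : ℕ → ℕ
  entry x = if evenᵇ x then a else 2 * a
  v = pattern-a2a n a
  lookup-v : ∀ j → lookup v j ≡ entry (toℕ j)
  lookup-v = lookup∘tabulate (entry ∘ toℕ)
  T : Fin (suc n) → ℕ
  T j = lookup v j * lookup v (succF j)
  T-inner : ∀ j → 2 ∣ T (inject₁ j)
  T-inner j = subst (2 ∣_) (sym (cong₂ _*_
    (trans (lookup-v (inject₁ j)) (cong entry (toℕ-inject₁ j)))
    (trans (cong (lookup v) (succF-inject₁ j)) (lookup-v (suc j)))))
    (2∣alternating (evenᵇ (toℕ j)) a)
  T-last : T (fromℕ n) ≡ a * a
  T-last = cong₂ _*_
    (trans (lookup-v (fromℕ n)) (cong (λ b → if b then a else 2 * a)
      (trans (cong evenᵇ (toℕ-fromℕ n)) (even⇒evenᵇ even-n))))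
    (cong (lookup v) succF-fromℕ)

lemma2 : (n : ℕ) → 2 ≤ n → Even n →
         (q : ℕ) → IsPrimePower q →
         (c : Coeffs n) →
         FunctionalEquations n q c →
         c (replicate (suc n) 0) ≡ 1ℚ →
         (∀ a → 1 ≤ a → c (replicate (suc n) a) ≡ 0ℚ) →
         ∀ a → Odd a → c (pattern-a2a n a) ≡ 0ℚ
lemma2 n 2≤n even-n .(p ^ k) (p , k , p-prime , _ , refl) c fe _ diag a odd-a =
  odd-vanishing 1≤n (ℕ→ℚ (p ^ k)) {{q>0}} c fe diag (pattern-a2a n a) (pattern-a2a-odd even-n odd-a)
  where
  1≤n : 1 ≤ n
  1≤n = ≤-trans (s≤s z≤n) 2≤n
  q>0 : ℚ.Positive (ℕ→ℚ (p ^ k))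
  q>0 = ℕ→ℚ-pos (p ^ k) {{m^n≢0 p k {{prime⇒nonZero p-prime}}}}
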